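{- Let $P$ be a program modelled as below and let $k_{max}\ge 1$ be an integer. Consider the run of $\mathrm{bkind}(P,k_{max},1,\emptyset)$ (which terminates after at most $k_{max}+1$ invocations). Then: (i) if it returns a nonempty sequence of states, that sequence is a counterexample (so $P$ is unsafe); (ii) if it returns $\emptyset$, then $P$ is safe; (iii) if it returns $\mathit{unknown}$, then $P$ is safe up to $k_{max}$.
   Context: A program $P$ is modelled as a transition system given by a set $S$ of states, a set $\mathit{init}_P\subseteq S$ of initial states, a transition relation $tr_P\subseteq S\times S$, a safety property $\phi\subseteq S$ and a completeness predicate $\psi\subseteq S$. Terminated executions are modelled by stuttering: every state has at least one $tr_P$-successor, and $\psi(s)$ holds iff the only $tr_P$-successor of $s$ is $s$ itself (all loops have been exited). A path is a finite sequence $s_1,\dots,s_m$ ($m\ge 1$) of states with $tr_P(s_i,s_{i+1})$ for $1\le i<m$; it is initial if $s_1\in\mathit{init}_P$. A state $s$ with $\neg\phi(s)$ is an error state. A counterexample is an initial path whose last state is an error state; its length is its number of states. $P$ is unsafe if a counterexample exists and safe otherwise; $P$ is safe up to $K$ if it has no counterexample of length at most $K$. $\emptyset$ denotes the empty sequence and $\cdot$ concatenation of sequences. Checks for a bound $k\ge1$ (each may return any witness satisfying its condition): - $\mathrm{bkind\_base\_case}_k(P,\pi_{back})$: if there is an initial path $s_1,\dots,s_k$ and an index $1\le i\le k$ with $\neg\phi(s_i)$, return $[s_1,\dots,s_i]$; else, if $\pi_{back}\neq\emptyset$ and there is an initial path $s_1,\dots,s_k$ and an index $1\le i\le k$ such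 that $s_i$ is the first state of $\pi_{back}$, return $[s_1,\dots,s_{i-1}]\cdot\pi_{back}$; otherwise return $\emptyset$. - $\mathrm{forward\_condition}_k(P)$: if there is an initial path $s_1,\dots,s_k$ with $\neg\psi(s_k)$, return $[s_1,\dots,s_k]$; otherwise return $\emptyset$. - $\mathrm{inductive\_step}_k(P)$: if there are states $t_0,\dots,t_k\in S$ (not necessarily initial or reachable) with $tr_P(t_i,t_{i+1})$ and $\phi(t_i)$ for all $0\le i<k$ and $\neg\phi(t_k)$, return $[t_0,\dots,t_k]$; otherwise return $\emptyset$. Algorithm $\mathrm{bkind}(P,k_{max},k,\pi_{back})$: if $k>k_{max}$ return $\mathit{unknown}$; let $\pi:=\mathrm{bkind\_base\_case}_k(P,\pi_{back})$, and if $\pi\neq\emptyset$ return $\pi$; let $\pi:=\mathrm{forward\_condition}_k(P)$, and if $\pi=\emptyset$ return $\emptyset$; let $\pi:=\mathrm{inductive\_step}_k(P)$, and if $\pi=\emptyset$ return $\emptyset$; otherwise return $\mathrm{bkind}(P,k_{max},k+1,\pi)$. -}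

module Defs where

open import Data.Nat using (ℕ; zero; suc; _≤_; _<_)
open import Data.List using (List; []; _∷_; _++_; [_]; length)
open import Data.List.Relation.Unary.All using (All)
open import Data.Maybe using (Maybe; just; nothing)
open import Data.Product using (Σ; ∃; _×_; _,_)
open import Data.Sum using (_⊎_)
open import Relation.Nullary using (¬_)
open import Relation.Binary.PropositionalEquality using (_≡_; _≢_)

-- A program modelled as a transition system (with stuttering termination).
record Program : Set₁ where
  field
    S      : Set
    init   : S → Set
    tr     : S → S → Set
    φ      : S → Set
    ψ      : S → Set
    total  : ∀ s → ∃ λ t → tr s t
    stutter⇒ : ∀ s → ψ s → tr s s × (∀ t → tr s t → t ≡ s)
    stutter⇐ : ∀ s → tr s s → (∀ t → tr s t → t ≡ s) → ψ s

module _ (P : Program) where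
  open Program P

  data IsPath : List S → Set where
    one  : ∀ s → IsPath [ s ]
    step : ∀ {s t xs} → tr s t → IsPath (t ∷ xs) → IsPath (s ∷ t ∷ xs)

  data Initial : List S → Set where
    initial : ∀ {s xs} → init s → Initial (s ∷ xs)

  InitPath : ℕ → List S → Set
  InitPath k xs = length xs ≡ k × IsPath xs × Initial xs

  Counterexample : List S → Set
  Counterexample π =
    IsPath π × Initial π × Σ (List S) λ pre → Σ S λ s → π ≡ pre ++ [ s ] × ¬ φ s

  HasCounterexample : Set
  HasCounterexample = ∃ λ π → Counterexample π

  Safe : Set
  Safe = ¬ HasCounterexample

  SafeUpTo : ℕ → Set
  SafeUpTo K = ¬ (∃ λ π → Counterexample π × length π ≤ K)

  -- witnesses of the first branch of bkind_base_case_k: [s₁,…,s_i] with ¬φ(s_i)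
  BaseErr : ℕ → List S → Set
  BaseErr k r = Σ (List S) λ xs → InitPath k xs ×
    Σ (List S) λ pre → Σ S λ s → Σ (List S) λ post →
      xs ≡ pre ++ s ∷ post × ¬ φ s × r ≡ pre ++ [ s ]

  -- witnesses of the second branch: [s₁,…,s_{i-1}] · π_back with s_i = head π_back
  BaseHit : ℕ → List S → List S → Set
  BaseHit k πb r = Σ (List S) λ xs → InitPath k xs ×
    Σ (List S) λ pre → Σ S λ s → Σ (List S) λ post → Σ (List S) λ rest →
      xs ≡ pre ++ s ∷ post × πb ≡ s ∷ rest × r ≡ pre ++ πb

  -- r is a permissible result of bkind_base_case_k(P, πb)
  BaseSpec : ℕ → List S → List S → Set
  BaseSpec k πb r =
    BaseErr k r
    ⊎ (¬ (∃ λ r' → BaseErr k r') × πb ≢ [] × BaseHit k πb r)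
    ⊎ (¬ (∃ λ r' → BaseErr k r') × ¬ (πb ≢ [] × ∃ λ r' → BaseHit k πb r') × r ≡ [])

  -- witnesses of forward_condition_k: initial path s₁,…,s_k with ¬ψ(s_k)
  FwdW : ℕ → List S → Set
  FwdW k r = InitPath k r × Σ (List S) λ pre → Σ S λ s → r ≡ pre ++ [ s ] × ¬ ψ s

  FwdSpec : ℕ → List S → Set
  FwdSpec k r = FwdW k r ⊎ (¬ (∃ λ r' → FwdW k r') × r ≡ [])

  -- witnesses of inductive_step_k: t₀,…,t_k path, φ(t₀..t_{k-1}), ¬φ(t_k)
  IndW : ℕ → List S → Set
  IndW k r = length r ≡ suc k × IsPath r ×
    Σ (List S) λ pre → Σ S λ s → r ≡ pre ++ [ s ] × All φ pre × ¬ φ s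

  IndSpec : ℕ → List S → Set
  IndSpec k r = IndW k r ⊎ (¬ (∃ λ r' → IndW k r') × r ≡ [])

  -- BKind kmax k πb res : res is a possible result of bkind(P, kmax, k, πb)
  -- (over all permissible choices of witnesses by the checks).
  -- Result: nothing = unknown, just [] = ∅, just π = the sequence π.
  data BKind (kmax : ℕ) : ℕ → List S → Maybe (List S) → Set where
    unknown : ∀ {k πb} → kmax < k → BKind kmax k πb nothing
    base    : ∀ {k πb π} → k ≤ kmax → BaseSpec k πb π → π ≢ [] →
              BKind kmax k πb (just π)
    fwd     : ∀ {k πb} → k ≤ kmax → BaseSpec k πb [] → FwdSpec k [] →
              BKind kmax k πb (just [])
    ind     : ∀ {k πb π₁} → k ≤ kmax → BaseSpec k πb [] → FwdSpec k π₁ → π₁ ≢ [] →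
              IndSpec k [] → BKind kmax k πb (just [])
    recurse : ∀ {k πb π₁ π₂ res} → k ≤ kmax → BaseSpec k πb [] → FwdSpec k π₁ → π₁ ≢ [] →
              IndSpec k π₂ → π₂ ≢ [] → BKind kmax (suc k) π₂ res →
              BKind kmax k πb res

-- Call a depth i error-free if no state reachable in exactly i steps violates φ.
-- A nonempty result is either an error found by a base case or an initial prefix
-- glued to the previous inductive-step witness, which is a path ending in an error;
-- either way it is a counterexample. A base case at bound k that finds nothing shows
-- that all depths below k are error-free, which gives (iii) once k exceeds kmax.
-- For (ii): if the forward condition fails at k, every state reachable in k − 1 or
-- more steps is complete, hence stutters, so errors at larger depths already occur at
-- smaller ones; if the inductive step fails at k, an error at depth i ≥ k would end a
-- path through k earlier reachable states, all safe by strong induction on i.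
-- Since φ and ψ need not be decidable, "safe" is used in the form ¬ ¬ φ, which
-- suffices because safety is a negative statement.
module Submission where

open import Defs
open import Data.Nat using (ℕ; suc; _+_; _∸_; _≤_; _<_; z≤n; s≤s)
open import Data.Nat.Properties
  using (+-comm; +-suc; m+[n∸m]≡n; ≤-pred; ≮⇒≥; <-≤-trans; m<n⇒m<1+n; n<1+n; m≤n⇒m<n∨m≡n; _<?_)
open import Data.Nat.Induction using (<-rec)
open import Data.List using (List; []; _∷_; _++_; [_]; _∷ʳ_; length)
open import Data.List.Properties using (++-assoc; ++-conicalʳ; length-++)
open import Data.List.Relation.Unary.All as All using (All; []; _∷_)
open import Data.List.Relation.Unary.All.Properties using (++⁺)
open import Data.Maybe using (Maybe; just; nothing)
open import Data.Product using (∃; ∃₂; _×_; _,_; proj₂)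
open import Data.Sum using (_⊎_; inj₁; inj₂)
open import Level using (0ℓ)
open import Relation.Nullary using (¬_; yes; no; contradiction)
open import Relation.Nullary.Negation using (¬¬-map; ¬¬-Monad)
open import Relation.Binary.PropositionalEquality
  using (_≡_; _≢_; refl; sym; trans; cong; subst; module ≡-Reasoning)

module _ (P : Program) where
  open Program P

  length-∷ʳ : ∀ (xs : List S) x → length (xs ∷ʳ x) ≡ suc (length xs)
  length-∷ʳ xs x = trans (length-++ xs) (+-comm (length xs) 1)

  ++∷-≢[] : ∀ (pre : List S) {s rest} → pre ++ s ∷ rest ≢ []
  ++∷-≢[] pre eq with () ← ++-conicalʳ pre _ eq

  IsPath-++ : ∀ pre {s rest} → IsPath P (pre ∷ʳ s) → IsPath P (s ∷ rest) → IsPath P (pre ++ s ∷ rest)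
  IsPath-++ []            _            q = q
  IsPath-++ (_ ∷ [])      (step st _)  q = step st q
  IsPath-++ (_ ∷ x ∷ pre) (step st p)  q = step st (IsPath-++ (x ∷ pre) p q)

  IsPath-∷ʳ : ∀ pre {s t} → IsPath P (pre ∷ʳ s) → tr s t → IsPath P (pre ∷ʳ s ∷ʳ t)
  IsPath-∷ʳ pre {s} {t} p st =
    subst (IsPath P) (sym (++-assoc pre [ s ] [ t ])) (IsPath-++ pre p (step st (one t)))

  IsPath-prefix : ∀ pre {s rest} → IsPath P (pre ++ s ∷ rest) → IsPath P (pre ∷ʳ s)
  IsPath-prefix []            _           = one _
  IsPath-prefix (_ ∷ [])      (step st _) = step st (one _)
  IsPath-prefix (_ ∷ x ∷ pre) (step st p) = step st (IsPath-prefix (x ∷ pre) p)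

  IsPath-from : ∀ n s → ∃ λ ys → IsPath P (s ∷ ys) × length ys ≡ n
  IsPath-from 0       s = [] , one s , refl
  IsPath-from (suc n) s with t , st ← total s with ys , p , refl ← IsPath-from n t =
    t ∷ ys , step st p , refl

  Initial-++ : ∀ {xs} ys → Initial P xs → Initial P (xs ++ ys)
  Initial-++ _ (initial ι) = initial ι

  Initial-resuffix : ∀ pre {s rest rest′} → Initial P (pre ++ s ∷ rest) → Initial P (pre ++ s ∷ rest′)
  Initial-resuffix []      (initial ι) = initial ι
  Initial-resuffix (_ ∷ _) (initial ι) = initial ι

  data Reachable : ℕ → S → Set where
    start : ∀ {s} → init s → Reachable 0 s
    next  : ∀ {i s t} → Reachable i s → tr s t → Reachable (suc i) t

  Reachable⇒path : ∀ {i s} → Reachable i s →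
    ∃ λ pre → IsPath P (pre ∷ʳ s) × Initial P (pre ∷ʳ s) × length pre ≡ i
  Reachable⇒path (start ι) = [] , one _ , initial ι , refl
  Reachable⇒path (next {s = s} r st) with pre , p , ι , refl ← Reachable⇒path r =
    pre ∷ʳ s , IsPath-∷ʳ pre p st , Initial-++ _ ι , length-∷ʳ pre s

  Reachable-along : ∀ pre {i s e} → Reachable i s → IsPath P (s ∷ pre ∷ʳ e) →
    Reachable (length pre + suc i) e
  Reachable-along []        r (step st (one _)) = next r st
  Reachable-along (_ ∷ pre) {i} {e = e} r (step st p) =
    subst (λ j → Reachable j e) (+-suc (length pre) (suc i)) (Reachable-along pre (next r st) p)

  Counterexample⇒Reachable : ∀ {π} → Counterexample P π →
    ∃₂ λ i e → Reachable i e × ¬ φ e × length π ≡ suc i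
  Counterexample⇒Reachable (_ , initial ι , []      , e , refl , ¬φe) = 0 , e , start ι , ¬φe , refl
  Counterexample⇒Reachable (p , initial ι , _ ∷ pre , e , refl , ¬φe) =
    _ , e , Reachable-along pre (start ι) p , ¬φe , cong suc (length-++ pre)

  ErrorFreeAt : ℕ → Set
  ErrorFreeAt i = ∀ {s} → Reachable i s → ¬ ¬ φ s

  ErrorFreeBelow : ℕ → Set
  ErrorFreeBelow n = ∀ {i} → i < n → ErrorFreeAt i

  ErrorFree : Set
  ErrorFree = ∀ i → ErrorFreeAt i

  ErrorFree⇒Safe : ErrorFree → Safe P
  ErrorFree⇒Safe errorFree (_ , ce) with i , _ , r , ¬φe , _ ← Counterexample⇒Reachable ce =
    errorFree i r ¬φe

  ErrorFreeBelow⇒SafeUpTo : ∀ {K} → ErrorFreeBelow K → SafeUpTo P K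
  ErrorFreeBelow⇒SafeUpTo {K} below (_ , ce , |π|≤K)
    with _ , _ , r , ¬φe , |π|≡1+i ← Counterexample⇒Reachable ce =
    below (subst (_≤ K) |π|≡1+i |π|≤K) r ¬φe

  noBaseErr⇒ErrorFreeBelow : ∀ {k} → ¬ ∃ (BaseErr P k) → ErrorFreeBelow k
  noBaseErr⇒ErrorFreeBelow {k} noErr {i} i<k {s} r ¬φs
    with pre , p , ι , refl ← Reachable⇒path r | post , q , |post| ← IsPath-from (k ∸ suc i) s =
    noErr (pre ∷ʳ s , (pre ++ s ∷ post , (|path|≡k , IsPath-++ pre p q , Initial-resuffix pre ι) ,
                       pre , s , post , refl , ¬φs , refl))
    where
    open ≡-Reasoning
    |path|≡k : length (pre ++ s ∷ post) ≡ k
    |path|≡k = begin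
      length (pre ++ s ∷ post)         ≡⟨ length-++ pre ⟩
      length pre + suc (length post)   ≡⟨ cong (λ n → length pre + suc n) |post| ⟩
      length pre + suc (k ∸ suc i)     ≡⟨ +-suc (length pre) _ ⟩
      suc i + (k ∸ suc i)              ≡⟨ m+[n∸m]≡n i<k ⟩
      k                                ∎

  complete-transport : ∀ (Q : S → Set) {s t} → ψ s → tr s t → Q s → Q t
  complete-transport Q ψs st = subst Q (sym (proj₂ (stutter⇒ _ ψs) _ st))

  noFwd⇒completeAt : ∀ {k} → ¬ ∃ (FwdW P (suc k)) → ∀ {s} → Reachable k s → ¬ ¬ ψ s
  noFwd⇒completeAt noFwd {s} r ¬ψs with pre , p , ι , refl ← Reachable⇒path r =
    noFwd (pre ∷ʳ s , (length-∷ʳ pre s , p , ι) , pre , s , refl , ¬ψs)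

  noFwd⇒completeFrom : ∀ {k} → ¬ ∃ (FwdW P (suc k)) → ∀ {i s} → Reachable i s → k ≤ i → ¬ ¬ ψ s
  noFwd⇒completeFrom noFwd r@(start _) z≤n = noFwd⇒completeAt noFwd r
  noFwd⇒completeFrom noFwd r@(next r′ st) k≤i with m≤n⇒m<n∨m≡n k≤i
  ... | inj₂ refl      = noFwd⇒completeAt noFwd r
  ... | inj₁ (s≤s k≤i′) =
    ¬¬-map (λ ψs → complete-transport ψ ψs st ψs) (noFwd⇒completeFrom noFwd r′ k≤i′)

  noFwd⇒ErrorFree : ∀ {k} → ErrorFreeBelow (suc k) → ¬ ∃ (FwdW P (suc k)) → ErrorFree
  noFwd⇒ErrorFree below _ 0 r = below (s≤s z≤n) r
  noFwd⇒ErrorFree {k} below noFwd (suc i) r@(next r′ st) with i <? k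
  ... | yes i<k = below (s≤s i<k) r
  ... | no  i≮k = λ ¬φt → noFwd⇒completeFrom noFwd r′ (≮⇒≥ i≮k) λ ψs →
    noFwd⇒ErrorFree below noFwd i r′ λ φs → ¬φt (complete-transport φ ψs st φs)

  ReachableBefore : ℕ → S → Set
  ReachableBefore i t = ∃ λ j → j < i × Reachable j t

  Reachable⇒trailingPath : ∀ k {i s} → Reachable i s → k ≤ i →
    ∃ λ pre → IsPath P (pre ∷ʳ s) × length pre ≡ k × All (ReachableBefore i) pre
  Reachable⇒trailingPath 0       _                           _         = [] , one _ , refl , []
  Reachable⇒trailingPath (suc k) (next {i = i} {s = s} r st) (s≤s k≤i)
    with pre , p , refl , earlier ← Reachable⇒trailingPath k r k≤i =
    pre ∷ʳ s , IsPath-∷ʳ pre p st , length-∷ʳ pre s ,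
    ++⁺ (All.map (λ (j , j<i , rj) → j , m<n⇒m<1+n j<i , rj) earlier) ((i , n<1+n i , r) ∷ [])

  noInd⇒ErrorFree : ∀ {k} → ErrorFreeBelow k → ¬ ∃ (IndW P k) → ErrorFree
  noInd⇒ErrorFree {k} below noInd = <-rec ErrorFreeAt errorFreeAt
    where
    errorFreeAt : ∀ i → ErrorFreeBelow i → ErrorFreeAt i
    errorFreeAt i earlier {s} r ¬φs with i <? k
    ... | yes i<k = below i<k r ¬φs
    ... | no  i≮k with pre , p , refl , history ← Reachable⇒trailingPath k r (≮⇒≥ i≮k) =
      All.mapM 0ℓ ¬¬-Monad (λ (_ , j<i , rj) → earlier j<i rj) history λ φpre →
        noInd (pre ∷ʳ s , length-∷ʳ pre s , p , pre , s , refl , φpre , ¬φs)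

  ErrorPath : List S → Set
  ErrorPath π = IsPath P π × ∃₂ λ pre e → π ≡ pre ∷ʳ e × ¬ φ e

  BaseErr⇒Counterexample : ∀ {k π} → BaseErr P k π → Counterexample P π
  BaseErr⇒Counterexample (_ , (_ , p , ι) , pre , s , _ , refl , ¬φs , refl) =
    IsPath-prefix pre p , Initial-resuffix pre ι , pre , s , refl , ¬φs

  BaseHit⇒Counterexample : ∀ {k πb π} → BaseHit P k πb π → ErrorPath πb → Counterexample P π
  BaseHit⇒Counterexample (_ , (_ , p , ι) , pre , s , _ , rest , refl , refl , refl) (q , pre′ , e , eq , ¬φe) =
    IsPath-++ pre (IsPath-prefix pre p) q , Initial-resuffix pre ι ,
    pre ++ pre′ , e , trans (cong (pre ++_) eq) (sym (++-assoc pre pre′ [ e ])) , ¬φe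

  BaseSpec⇒Counterexample : ∀ {k πb π} → πb ≡ [] ⊎ ErrorPath πb → BaseSpec P k πb π → π ≢ [] →
    Counterexample P π
  BaseSpec⇒Counterexample _            (inj₁ err)                    _     = BaseErr⇒Counterexample err
  BaseSpec⇒Counterexample (inj₁ refl)  (inj₂ (inj₁ (_ , []≢[] , _))) _     = contradiction refl []≢[]
  BaseSpec⇒Counterexample (inj₂ πbErr) (inj₂ (inj₁ (_ , _ , hit)))   _     = BaseHit⇒Counterexample hit πbErr
  BaseSpec⇒Counterexample _            (inj₂ (inj₂ (_ , _ , refl)))  []≢[] = contradiction refl []≢[]

  BaseSpec-[]⇒ErrorFreeBelow : ∀ {k πb} → BaseSpec P k πb [] → ErrorFreeBelow k
  BaseSpec-[]⇒ErrorFreeBelow (inj₁ (_ , _ , pre , _ , _ , _ , _ , eq)) = contradiction (sym eq) (++∷-≢[] pre)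
  BaseSpec-[]⇒ErrorFreeBelow (inj₂ (inj₁ (_ , _ , _ , _ , pre , _ , _ , _ , _ , refl , eq))) =
    contradiction (sym eq) (++∷-≢[] pre)
  BaseSpec-[]⇒ErrorFreeBelow (inj₂ (inj₂ (noErr , _))) = noBaseErr⇒ErrorFreeBelow noErr

  FwdSpec-[]⇒noFwd : ∀ {k} → FwdSpec P k [] → ¬ ∃ (FwdW P k)
  FwdSpec-[]⇒noFwd (inj₁ (_ , pre , _ , eq , _)) = contradiction (sym eq) (++∷-≢[] pre)
  FwdSpec-[]⇒noFwd (inj₂ (noFwd , _))            = noFwd

  IndSpec-[]⇒noInd : ∀ {k} → IndSpec P k [] → ¬ ∃ (IndW P k)
  IndSpec-[]⇒noInd (inj₁ (_ , _ , pre , _ , eq , _)) = contradiction (sym eq) (++∷-≢[] pre)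
  IndSpec-[]⇒noInd (inj₂ (noInd , _))                = noInd

  IndSpec⇒ErrorPath : ∀ {k π} → IndSpec P k π → π ≢ [] → ErrorPath π
  IndSpec⇒ErrorPath (inj₁ (_ , p , pre , e , eq , _ , ¬φe)) _     = p , pre , e , eq , ¬φe
  IndSpec⇒ErrorPath (inj₂ (_ , refl))                       []≢[] = contradiction refl []≢[]

  bkind-counterexample : ∀ {kmax k πb π} → BKind P kmax k πb (just π) → π ≢ [] →
    πb ≡ [] ⊎ ErrorPath πb → Counterexample P π
  bkind-counterexample (base _ baseSpec π≢[]) _     πb = BaseSpec⇒Counterexample πb baseSpec π≢[]
  bkind-counterexample (fwd _ _ _)            []≢[] _  = contradiction refl []≢[]
  bkind-counterexample (ind _ _ _ _ _)        []≢[] _  = contradiction refl []≢[]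
  bkind-counterexample (recurse _ _ _ _ indSpec π₂≢[] run) π≢[] _ =
    bkind-counterexample run π≢[] (inj₂ (IndSpec⇒ErrorPath indSpec π₂≢[]))

  bkind-∅⇒Safe : ∀ {kmax k πb} → BKind P kmax (suc k) πb (just []) → Safe P
  bkind-∅⇒Safe (base _ _ []≢[])             = contradiction refl []≢[]
  bkind-∅⇒Safe (fwd _ baseSpec fwdSpec)     =
    ErrorFree⇒Safe (noFwd⇒ErrorFree (BaseSpec-[]⇒ErrorFreeBelow baseSpec) (FwdSpec-[]⇒noFwd fwdSpec))
  bkind-∅⇒Safe (ind _ baseSpec _ _ indSpec) =
    ErrorFree⇒Safe (noInd⇒ErrorFree (BaseSpec-[]⇒ErrorFreeBelow baseSpec) (IndSpec-[]⇒noInd indSpec))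
  bkind-∅⇒Safe (recurse _ _ _ _ _ _ run)    = bkind-∅⇒Safe run

  bkind-unknown⇒SafeUpTo : ∀ {kmax k πb} → ErrorFreeBelow k → BKind P kmax (suc k) πb nothing →
    SafeUpTo P kmax
  bkind-unknown⇒SafeUpTo below (unknown kmax<1+k) =
    ErrorFreeBelow⇒SafeUpTo λ i<kmax → below (<-≤-trans i<kmax (≤-pred kmax<1+k))
  bkind-unknown⇒SafeUpTo _ (recurse _ baseSpec _ _ _ _ run) =
    bkind-unknown⇒SafeUpTo (BaseSpec-[]⇒ErrorFreeBelow baseSpec) run

theorem4 : (P : Program) (kmax : ℕ) → 1 ≤ kmax →
           (res : Maybe (List (Program.S P))) → BKind P kmax 1 [] res →
           ((π : List (Program.S P)) → res ≡ just π → π ≢ [] → Counterexample P π)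
           × (res ≡ just [] → Safe P)
           × (res ≡ nothing → SafeUpTo P kmax)
theorem4 P kmax _ res run =
    (λ π res≡π π≢[] → bkind-counterexample P (result res≡π) π≢[] (inj₁ refl))
  , (λ res≡∅ → bkind-∅⇒Safe P (result res≡∅))
  , (λ res≡unknown → bkind-unknown⇒SafeUpTo P (λ ()) (result res≡unknown))
  where
  result : ∀ {res′} → res ≡ res′ → BKind P kmax 1 [] res′
  result res≡res′ = subst (BKind P kmax 1 []) res≡res′ run
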